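{- Let $d\geq 2$, let $k=\lfloor d/2\rfloor$, and let $s:\mathbb{N}\to\mathbb{N}$, $n\mapsto s(n)\ge 1$, satisfy $s(n)=o(n)$. For sufficiently large $n$, write $s=s(n)$ and let $\mathcal{F}^{n,d}_s$ be the following family of $d$-subsets of $[n]=\{1,\dots,n\}$: if $d=2k$, $$\mathcal{F}^{n,d}_{s}=\{\{i_1<i_2<\dots< i_{2k}\}\subseteq[n]: \exists\, 1\leq \ell \leq s \text{ such that } i_{2j}-i_{2j-1}=\ell \ \text{for all } 1\leq j\leq k \};$$ if $d=2k+1$, $$\mathcal{F}^{n,d}_{s}=\{\{i_1<\dots<i_{2k}< i_{2k+1}\}\subseteq[n] : i_{2k+1}-i_{2k}\leq s \text{ and } \exists\, 1\leq \ell \leq s \text{ such that } i_{2j}-i_{2j-1}=\ell \ \text{for all } 1\leq j\leq k\}.$$ Let $T$ denote the minimum size of a subset of $[n]$ meeting every member of $\mathcal{F}^{n,d}_s$ (the transversal number of the pure $(d-1)$-dimensional complex with facet set $\mathcal{F}^{n,d}_s$). Then $T\geq n\left(1-\frac{1}{s+1}\right)-ks$ if $d=2k$, and $T\geq n\left(1-\frac{2}{s+2}\right)-2ks$ if $d=2k+1$. Furthermore, $\mathcal{F}^{n,d}_s$ has a transversal of size $n-\lfloor \frac{n}{s+1}\rfloor$.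
   Context: A transversal of a family of sets (or of a pure simplicial complex, with respect to its facets) is a set of vertices meeting every member (every facet). -}

module Defs where

open import Data.Nat using (ℕ; zero; suc; _+_; _*_; _≤_; _<_; _%_; _/_)
open import Data.Fin using (Fin; toℕ; fromℕ<)
open import Data.Fin.Subset using (Subset; _∈_)
open import Data.Product using (Σ; ∃; _×_)
open import Data.Integer using (+_)
import Data.Rational as ℚ
open import Relation.Binary.PropositionalEquality using (_≡_)

-- s(n) = o(n) for s : ℕ → ℕ :  for every m ≥ 1, eventually m * s(n) ≤ n
-- (i.e. s(n)/n < 1/m eventually; equivalent to s(n)/n → 0).
LittleO : (ℕ → ℕ) → Set
LittleO s = ∀ m → 1 ≤ m → ∃ λ N → ∀ n → N ≤ n → m * s n ≤ n

-- A d-subset {i_1 < ... < i_d} of [n] is represented by its increasing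
-- enumeration  i : Fin d → Fin n  (0-based values, 0-based positions).
-- value at ℕ-position m (with a proof m < d)
at : {d n : ℕ} → (Fin d → Fin n) → (m : ℕ) → m < d → ℕ
at i m p = toℕ (i (fromℕ< p))

StrictlyIncreasing : {d n : ℕ} → (Fin d → Fin n) → Set
StrictlyIncreasing {d} i = ∀ m (p : suc m < d) → at i m (Data.Nat.Properties.<-trans (Data.Nat.Properties.n<1+n m) p) < at i (suc m) p
  where import Data.Nat.Properties

-- Pair condition: exists 1 ≤ ℓ ≤ s with i_{2j} - i_{2j-1} = ℓ for all 1 ≤ j ≤ k = ⌊d/2⌋
-- (0-based: positions 2j' and 2j'+1 for all j' with 2j'+1 < d, i.e. j' < k).
-- Odd tail condition (only when d is odd, d = 2k+1): i_{2k+1} - i_{2k} ≤ s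
-- (0-based: last position d-1 = m+1 and the one before, m).
InFamily : (n d s : ℕ) → (Fin d → Fin n) → Set
InFamily n d s i =
  StrictlyIncreasing i
  × (∃ λ ℓ → 1 ≤ ℓ × ℓ ≤ s ×
       (∀ j (p : suc (2 * j) < d) →
          at i (suc (2 * j)) p ≡ at i (2 * j) (Data.Nat.Properties.<-trans (Data.Nat.Properties.n<1+n (2 * j)) p) + ℓ))
  × (d % 2 ≡ 1 → ∀ m (p : suc m < d) → suc (suc m) ≡ d →
       at i (suc m) p ≤ at i m (Data.Nat.Properties.<-trans (Data.Nat.Properties.n<1+n m) p) + s)
  where import Data.Nat.Properties

Transversal : (n d s : ℕ) → Subset n → Set
Transversal n d s S = ∀ (i : Fin d → Fin n) → InFamily n d s i → ∃ λ (m : Fin d) → i m ∈ S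

ℕ→ℚ : ℕ → ℚ.ℚ
ℕ→ℚ n = (+ n) ℚ./ 1

module Submission where

-- Let U be the complement of a transversal, listed increasingly, and consider the gaps between
-- consecutive elements of U. Fix 1 ≤ ℓ ≤ s and scan U from the left, greedily taking disjoint pairs of
-- consecutive elements at distance ℓ (for odd d, also requiring the next element to lie within s of
-- the pair). Reaching k = ⌊d/2⌋ pairs would put a member of the family inside U, so at most 2(k − 1)
-- gaps equal ℓ (for odd d: equal ℓ and are followed by a gap ≤ s). The gaps add up to less than n.
-- For even d, giving each gap g the weight (s + 1 − g)⁺ yields |U|(s + 1) ≤ n + ks(s + 1); for odd d,
-- an amortised count over consecutive pairs of gaps yields |U|(s + 2) ≤ 2n + 2ks(s + 2). These are the
-- stated bounds on |S| = n − |U|. Conversely, removing every (s + 1)-st point of [n] leaves a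
-- transversal, since removed points are more than s apart.

open import Defs
open import Data.Nat using (ℕ; suc; _+_; _*_; _≤_; _∸_; _%_; _/_)
open import Data.Fin.Subset using (Subset; ∣_∣)
open import Data.Product using (∃; _×_)
open import Data.Integer using (+_)
open import Data.Rational using (ℚ; 1ℚ) renaming (_≤_ to _≤ℚ_; _*_ to _*ℚ_; _-_ to _-ℚ_; _/_ to _/ℚ_)
open import Relation.Binary.PropositionalEquality using (_≡_)

open import Data.Empty using (⊥; ⊥-elim)
open import Data.Fin using (Fin; zero; suc; toℕ; fromℕ<)
open import Data.Fin.Properties using (toℕ<n; toℕ-fromℕ<)
open import Data.Fin.Subset using (inside; outside; ∁; _∉_) renaming (_∈_ to _∈ₛ_)
open import Data.Fin.Subset.Properties using (_∈?_; x∈∁p⇒x∉p; x∉∁p⇒x∈p; ∣∁p∣≡n∸∣p∣; ∣p∣≤n)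
import Data.Integer as ℤ
import Data.Integer.Properties as ℤ
import Data.Integer.Tactic.RingSolver as ℤ-Solver
open import Data.List using (List; []; _∷_; length; map; head)
open import Data.List.Properties using (length-map)
open import Data.List.Membership.Propositional using (_∈_)
open import Data.List.Membership.Propositional.Properties using (∈-map⁺; ∈-map⁻)
open import Data.List.Relation.Unary.Any using (here; there)
open import Data.List.Relation.Unary.All as All using (All; []; _∷_)
import Data.List.Relation.Unary.All.Properties as All
open import Data.List.Relation.Unary.AllPairs as AllPairs using (AllPairs; []; _∷_)
import Data.List.Relation.Unary.AllPairs.Properties as AllPairs
open import Data.Maybe using (fromMaybe)
open import Data.Nat using (zero; _<_; z≤n; s≤s; s≤s⁻¹; z<s; s<s)
open import Data.Nat.DivMod using (m≡m%n+[m/n]*n; m≥n⇒m/n>0; m<n⇒m/n≡0; m/n≡1+[m∸n]/n)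
open import Data.Nat.ListAction using (sum)
open import Data.Nat.Properties
open import Algebra.Properties.CommutativeSemigroup +-commutativeSemigroup using () renaming (interchange to +-interchange)
open import Data.Nat.Tactic.RingSolver using (solve-∀)
open import Data.Product using (_,_; proj₁; proj₂; uncurry)
open import Data.Rational using (toℚᵘ) renaming (-_ to -ℚ_)
import Data.Rational.Properties as ℚₚ
import Data.Rational.Unnormalised as ℚᵘ
open ℚᵘ using (mkℚᵘ; *≡*; *≤*; _≃_; 1ℚᵘ; 0ℚᵘ) renaming (_+_ to _+ᵘ_; _*_ to _*ᵘ_; _-_ to _-ᵘ_; _≤_ to _≤ᵘ_)
import Data.Rational.Unnormalised.Properties as ℚᵘₚ
open import Data.Rational.Unnormalised.Solver using (module +-*-Solver)
open import Data.Sum as Sum using (_⊎_; inj₁; inj₂; [_,_]′)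
open import Data.Unit using (⊤; tt)
import Data.Vec.Base as Vec
open Vec using ([]; _∷_)
open import Function using (id; _∘_)
open import Relation.Binary.PropositionalEquality using (refl; sym; trans; cong; cong₂; subst; subst₂; module ≡-Reasoning)
open import Relation.Nullary using (¬_; Dec; yes; no; contradiction; _×-dec_)
open import Relation.Unary using (Decidable)

∑₁ : ℕ → (ℕ → ℕ) → ℕ
∑₁ zero    f = 0
∑₁ (suc s) f = f (suc s) + ∑₁ s f

∑₁-cong : ∀ s {f g : ℕ → ℕ} → (∀ v → 1 ≤ v → v ≤ s → f v ≡ g v) → ∑₁ s f ≡ ∑₁ s g
∑₁-cong zero    eq = refl
∑₁-cong (suc s) eq = cong₂ _+_ (eq (suc s) (s≤s z≤n) ≤-refl) (∑₁-cong s λ v 1≤v v≤s → eq v 1≤v (m≤n⇒m≤1+n v≤s))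

∑₁-mono-≤ : ∀ s {f g : ℕ → ℕ} → (∀ v → 1 ≤ v → v ≤ s → f v ≤ g v) → ∑₁ s f ≤ ∑₁ s g
∑₁-mono-≤ zero    le = z≤n
∑₁-mono-≤ (suc s) le = +-mono-≤ (le (suc s) (s≤s z≤n) ≤-refl) (∑₁-mono-≤ s λ v 1≤v v≤s → le v 1≤v (m≤n⇒m≤1+n v≤s))

∑₁-distrib-+ : ∀ s (f g : ℕ → ℕ) → ∑₁ s (λ v → f v + g v) ≡ ∑₁ s f + ∑₁ s g
∑₁-distrib-+ zero    f g = refl
∑₁-distrib-+ (suc s) f g = begin
  (f (suc s) + g (suc s)) + ∑₁ s (λ v → f v + g v) ≡⟨ cong (_+_ (f (suc s) + g (suc s))) (∑₁-distrib-+ s f g) ⟩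
  (f (suc s) + g (suc s)) + (∑₁ s f + ∑₁ s g)       ≡⟨ +-interchange (f (suc s)) (g (suc s)) (∑₁ s f) (∑₁ s g) ⟩
  (f (suc s) + ∑₁ s f) + (g (suc s) + ∑₁ s g)       ∎
  where open ≡-Reasoning

∑₁-distribˡ-* : ∀ s c (f : ℕ → ℕ) → ∑₁ s (λ v → c * f v) ≡ c * ∑₁ s f
∑₁-distribˡ-* zero    c f = sym (*-zeroʳ c)
∑₁-distribˡ-* (suc s) c f =
  trans (cong (_+_ (c * f (suc s))) (∑₁-distribˡ-* s c f)) (sym (*-distribˡ-+ c (f (suc s)) (∑₁ s f)))

∑₁-const : ∀ s c → ∑₁ s (λ _ → c) ≡ s * c
∑₁-const zero    c = refl
∑₁-const (suc s) c = cong (_+_ c) (∑₁-const s c)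

term≤∑₁ : ∀ s (f : ℕ → ℕ) {v} → 1 ≤ v → v ≤ s → f v ≤ ∑₁ s f
term≤∑₁ zero    f (s≤s _) ()
term≤∑₁ (suc s) f {v} 1≤v v≤1+s with v ≟ suc s
... | yes refl = m≤m+n (f (suc s)) (∑₁ s f)
... | no v≢1+s = ≤-trans (term≤∑₁ s f 1≤v (s≤s⁻¹ (≤∧≢⇒< v≤1+s v≢1+s))) (m≤n+m (∑₁ s f) (f (suc s)))

∑₁-weights : ∀ s → 2 * ∑₁ s (λ v → suc s ∸ v) ≡ s * suc s
∑₁-weights zero    = refl
∑₁-weights (suc s) = begin
  2 * (suc (suc s) ∸ suc s + ∑₁ s (λ v → suc (suc s) ∸ v)) ≡⟨ cong (2 *_) (cong₂ _+_ (m+n∸n≡m 1 (suc s)) shift) ⟩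
  2 * (1 + ∑₁ s (λ v → 1 + (suc s ∸ v)))                  ≡⟨ cong (λ x → 2 * (1 + x)) split ⟩
  2 * (1 + (s + W))                                       ≡⟨ expand s W ⟩
  2 * (1 + s) + 2 * W                                     ≡⟨ cong (_+_ (2 * (1 + s))) (∑₁-weights s) ⟩
  2 * (1 + s) + s * suc s                                 ≡⟨ collect s ⟩
  suc s * suc (suc s)                                     ∎
  where
  open ≡-Reasoning
  W : ℕ
  W = ∑₁ s (λ v → suc s ∸ v)
  shift : ∑₁ s (λ v → suc (suc s) ∸ v) ≡ ∑₁ s (λ v → 1 + (suc s ∸ v))
  shift = ∑₁-cong s λ v _ v≤s → +-∸-assoc 1 (m≤n⇒m≤1+n v≤s)
  split : ∑₁ s (λ v → 1 + (suc s ∸ v)) ≡ s + W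
  split = trans (∑₁-distrib-+ s (λ _ → 1) (λ v → suc s ∸ v)) (cong (_+ W) (trans (∑₁-const s 1) (*-identityʳ s)))
  expand : ∀ s w → 2 * (1 + (s + w)) ≡ 2 * (1 + s) + 2 * w
  expand = solve-∀
  collect : ∀ s → 2 * (1 + s) + s * suc s ≡ suc s * suc (suc s)
  collect = solve-∀

-- Gap statistics and the length of a list

indicator : {P : Set} → Dec P → ℕ
indicator (yes _) = 1
indicator (no _)  = 0

indicator≤1 : {P : Set} (p? : Dec P) → indicator p? ≤ 1
indicator≤1 (yes _) = ≤-refl
indicator≤1 (no _)  = z≤n

indicator-yes : {P : Set} (p? : Dec P) → P → indicator p? ≡ 1
indicator-yes (yes _) _ = refl
indicator-yes (no ¬p) p = contradiction p ¬p

module _ {A : Set} {P : List A → Set} (P? : Decidable P) where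

  countSuffixes : List A → ℕ
  countSuffixes []       = 0
  countSuffixes (x ∷ xs) = indicator (P? (x ∷ xs)) + countSuffixes xs

  countSuffixes-∷-≥ : ∀ x xs → countSuffixes xs ≤ countSuffixes (x ∷ xs)
  countSuffixes-∷-≥ x xs = m≤n+m (countSuffixes xs) (indicator (P? (x ∷ xs)))

  countSuffixes-∷-≤ : ∀ x xs → countSuffixes (x ∷ xs) ≤ suc (countSuffixes xs)
  countSuffixes-∷-≤ x xs = +-monoˡ-≤ (countSuffixes xs) (indicator≤1 (P? (x ∷ xs)))

  countSuffixes-∷-yes : ∀ x xs → P (x ∷ xs) → countSuffixes (x ∷ xs) ≡ suc (countSuffixes xs)
  countSuffixes-∷-yes x xs p = cong (_+ countSuffixes xs) (indicator-yes (P? (x ∷ xs)) p)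

HeadIs : ℕ → List ℕ → Set
HeadIs v []      = ⊥
HeadIs v (g ∷ _) = g ≡ v

headIs? : ∀ v → Decidable (HeadIs v)
headIs? v []      = no λ ()
headIs? v (g ∷ _) = g ≟ v

FirstTwo : (ℕ → ℕ → Set) → List ℕ → Set
FirstTwo R (g ∷ g′ ∷ _) = R g g′
FirstTwo R _            = ⊥

firstTwo? : {R : ℕ → ℕ → Set} → (∀ g g′ → Dec (R g g′)) → Decidable (FirstTwo R)
firstTwo? R? []           = no λ ()
firstTwo? R? (g ∷ [])     = no λ ()
firstTwo? R? (g ∷ g′ ∷ _) = R? g g′

Tight : ℕ → List ℕ → Set
Tight s = FirstTwo λ g g′ → g ≤ s × g′ ≤ s

tight? : ∀ s → Decidable (Tight s)
tight? s = firstTwo? λ g g′ → (g ≤? s) ×-dec (g′ ≤? s)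

OpensWith : ℕ → ℕ → List ℕ → Set
OpensWith s v = FirstTwo λ g g′ → g ≡ v × g′ ≤ s

opensWith? : ∀ s v → Decidable (OpensWith s v)
opensWith? s v = firstTwo? λ g g′ → (g ≟ v) ×-dec (g′ ≤? s)

double : ℕ → ℕ
double zero    = zero
double (suc k) = suc (suc (double k))

double≡2* : ∀ k → double k ≡ 2 * k
double≡2* zero    = refl
double≡2* (suc k) = trans (cong (λ m → suc (suc m)) (double≡2* k)) (sym (*-distribˡ-+ 2 1 k))

weight≤∑₁-indicator : ∀ s {g} → 1 ≤ g → suc s ∸ g ≤ ∑₁ s (λ v → indicator (g ≟ v) * (suc s ∸ v))
weight≤∑₁-indicator s {g} 1≤g with g ≤? s
... | yes g≤s = subst (_≤ ∑₁ s hit) (trans (cong (_* (suc s ∸ g)) (indicator-yes (g ≟ g) refl)) (*-identityˡ _))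
                  (term≤∑₁ s hit 1≤g g≤s)
  where
  hit : ℕ → ℕ
  hit v = indicator (g ≟ v) * (suc s ∸ v)
... | no g≰s  = ≤-trans (≤-reflexive (m≤n⇒m∸n≡0 (≰⇒> g≰s))) z≤n

module _ (s : ℕ) where

  weightedRepeats : List ℕ → ℕ
  weightedRepeats gs = ∑₁ s λ v → countSuffixes (headIs? v) gs * (suc s ∸ v)

  -- A gap g contributes g + (s + 1 ∸ g) ≥ s + 1, and its weight s + 1 ∸ g is charged to the value v = g.
  length*≤sum+weightedRepeats : ∀ gs → All (1 ≤_) gs → length gs * suc s ≤ sum gs + weightedRepeats gs
  length*≤sum+weightedRepeats []       []           = z≤n
  length*≤sum+weightedRepeats (g ∷ gs) (1≤g ∷ 1≤gs) = begin
    suc s + length gs * suc s                         ≤⟨ +-mono-≤ (m≤n+m∸n (suc s) g) (length*≤sum+weightedRepeats gs 1≤gs) ⟩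
    (g + (suc s ∸ g)) + (sum gs + weightedRepeats gs) ≡⟨ +-interchange g _ (sum gs) _ ⟩
    (g + sum gs) + ((suc s ∸ g) + weightedRepeats gs) ≤⟨ +-monoʳ-≤ (g + sum gs) (+-monoˡ-≤ _ (weight≤∑₁-indicator s 1≤g)) ⟩
    (g + sum gs) + (∑₁ s hit + weightedRepeats gs)    ≡⟨ cong (_+_ (g + sum gs)) merge ⟩
    (g + sum gs) + weightedRepeats (g ∷ gs)           ∎
    where
    open ≤-Reasoning
    hit : ℕ → ℕ
    hit v = indicator (g ≟ v) * (suc s ∸ v)
    merge : ∑₁ s hit + weightedRepeats gs ≡ weightedRepeats (g ∷ gs)
    merge = trans (sym (∑₁-distrib-+ s hit _))
                  (∑₁-cong s λ v _ _ → sym (*-distribʳ-+ (suc s ∸ v) (indicator (g ≟ v)) (countSuffixes (headIs? v) gs)))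

  length*≤sum+repeats : ∀ k gs → All (1 ≤_) gs → (∀ v → 1 ≤ v → v ≤ s → countSuffixes (headIs? v) gs ≤ double k) →
                        length gs * suc s ≤ sum gs + k * (s * suc s)
  length*≤sum+repeats k gs 1≤gs few = begin
    length gs * suc s                             ≤⟨ length*≤sum+weightedRepeats gs 1≤gs ⟩
    sum gs + weightedRepeats gs                   ≤⟨ +-monoʳ-≤ (sum gs) (∑₁-mono-≤ s λ v 1≤v v≤s → *-monoˡ-≤ (suc s ∸ v) (few v 1≤v v≤s)) ⟩
    sum gs + ∑₁ s (λ v → double k * (suc s ∸ v)) ≡⟨ cong (_+_ (sum gs)) (∑₁-distribˡ-* s (double k) (λ v → suc s ∸ v)) ⟩
    sum gs + double k * W                         ≡⟨ cong (λ m → sum gs + m * W) (double≡2* k) ⟩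
    sum gs + 2 * k * W                            ≡⟨ cong (_+_ (sum gs)) (*-regroup k W) ⟩
    sum gs + k * (2 * W)                          ≡⟨ cong (λ x → sum gs + k * x) (∑₁-weights s) ⟩
    sum gs + k * (s * suc s)                      ∎
    where
    open ≤-Reasoning
    W : ℕ
    W = ∑₁ s (λ v → suc s ∸ v)
    *-regroup : ∀ k w → 2 * k * w ≡ k * (2 * w)
    *-regroup = solve-∀

module _ (s : ℕ) where

  private
    P : ℕ
    P = suc (suc s)

  tightCount : List ℕ → ℕ
  tightCount = countSuffixes (tight? s)

  TightBound : List ℕ → Set
  TightBound gs = length gs * P ≤ 2 * sum gs + suc (tightCount gs) * P

  -- Each gap needs s + 2 on the right: a gap g > s gets it from 2g, a gap ≤ s followed by a gap g′ > s
  -- shares 2(g + g′) ≥ 2(s + 2) with it, and a gap ≤ s followed by a gap ≤ s is charged to tightCount.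
  TightBound-∷-∷ : ∀ {g g′ gs} → 1 ≤ g → TightBound (g′ ∷ gs) → TightBound gs → TightBound (g ∷ g′ ∷ gs)
  TightBound-∷-∷ {g} {g′} {gs} 1≤g IH₁ IH₂ =
    [ (λ g≤s → [ both-small g≤s , second-large ]′ (≤-<-connex g′ s)) , first-large ]′ (≤-<-connex g s)
    where
    open ≤-Reasoning
    S′ : ℕ
    S′ = sum (g′ ∷ gs)
    grows : tightCount (g′ ∷ gs) ≤ tightCount (g ∷ g′ ∷ gs)
    grows = countSuffixes-∷-≥ (tight? s) g (g′ ∷ gs)

    first-large : s < g → TightBound (g ∷ g′ ∷ gs)
    first-large s<g = begin
      P + length (g′ ∷ gs) * P                            ≤⟨ +-mono-≤ (+-mono-≤ 1≤g s<g) IH₁ ⟩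
      (g + g) + (2 * S′ + suc (tightCount (g′ ∷ gs)) * P) ≡⟨ regroup g S′ _ ⟩
      2 * (g + S′) + suc (tightCount (g′ ∷ gs)) * P       ≤⟨ +-monoʳ-≤ (2 * (g + S′)) (*-monoˡ-≤ P (s≤s grows)) ⟩
      2 * (g + S′) + suc (tightCount (g ∷ g′ ∷ gs)) * P   ∎
      where
      regroup : ∀ g S X → (g + g) + (2 * S + X) ≡ 2 * (g + S) + X
      regroup = solve-∀

    both-small : g ≤ s → g′ ≤ s → TightBound (g ∷ g′ ∷ gs)
    both-small g≤s g′≤s = begin
      P + length (g′ ∷ gs) * P                          ≤⟨ +-monoʳ-≤ P IH₁ ⟩
      P + (2 * S′ + suc (tightCount (g′ ∷ gs)) * P)     ≡⟨ regroup P (2 * S′) _ ⟩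
      2 * S′ + suc (suc (tightCount (g′ ∷ gs))) * P     ≡⟨ cong (λ t → 2 * S′ + suc t * P) (sym tight-here) ⟩
      2 * S′ + suc (tightCount (g ∷ g′ ∷ gs)) * P       ≤⟨ +-monoˡ-≤ _ (*-monoʳ-≤ 2 (m≤n+m S′ g)) ⟩
      2 * (g + S′) + suc (tightCount (g ∷ g′ ∷ gs)) * P ∎
      where
      tight-here : tightCount (g ∷ g′ ∷ gs) ≡ suc (tightCount (g′ ∷ gs))
      tight-here = countSuffixes-∷-yes (tight? s) g (g′ ∷ gs) (g≤s , g′≤s)
      regroup : ∀ p a b → p + (a + b) ≡ a + (p + b)
      regroup = solve-∀

    second-large : s < g′ → TightBound (g ∷ g′ ∷ gs)
    second-large s<g′ = begin
      P + (P + length gs * P)                                        ≤⟨ +-mono-≤ P≤g+g′ (+-mono-≤ P≤g+g′ IH₂) ⟩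
      (g + g′) + ((g + g′) + (2 * sum gs + suc (tightCount gs) * P)) ≡⟨ regroup g g′ (sum gs) _ ⟩
      2 * (g + S′) + suc (tightCount gs) * P                         ≤⟨ +-monoʳ-≤ (2 * (g + S′)) (*-monoˡ-≤ P (s≤s grows₂)) ⟩
      2 * (g + S′) + suc (tightCount (g ∷ g′ ∷ gs)) * P              ∎
      where
      P≤g+g′ : P ≤ g + g′
      P≤g+g′ = +-mono-≤ 1≤g s<g′
      grows₂ : tightCount gs ≤ tightCount (g ∷ g′ ∷ gs)
      grows₂ = ≤-trans (countSuffixes-∷-≥ (tight? s) g′ gs) grows
      regroup : ∀ g h S X → (g + h) + ((g + h) + (2 * S + X)) ≡ 2 * (g + (h + S)) + X
      regroup = solve-∀

  tightBound : ∀ gs → All (1 ≤_) gs → TightBound gs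
  tightBound []            []                  = z≤n
  tightBound (g ∷ [])      _                   = ≤-trans (≤-reflexive (+-identityʳ P)) (≤-trans (m≤m+n P _) (m≤n+m _ (2 * (g + 0))))
  tightBound (g ∷ g′ ∷ gs) (1≤g ∷ 1≤g′ ∷ 1≤gs) =
    TightBound-∷-∷ {g} {g′} {gs} 1≤g (tightBound (g′ ∷ gs) (1≤g′ ∷ 1≤gs)) (tightBound gs 1≤gs)

  tightCount≤∑₁ : ∀ gs → All (1 ≤_) gs → tightCount gs ≤ ∑₁ s (λ v → countSuffixes (opensWith? s v) gs)
  tightCount≤∑₁ []       []           = z≤n
  tightCount≤∑₁ (g ∷ gs) (1≤g ∷ 1≤gs) = begin
    indicator (tight? s (g ∷ gs)) + tightCount gs
      ≤⟨ +-mono-≤ (tight⇒opens gs) (tightCount≤∑₁ gs 1≤gs) ⟩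
    ∑₁ s (λ v → indicator (opensWith? s v (g ∷ gs))) + ∑₁ s (λ v → countSuffixes (opensWith? s v) gs)
      ≡⟨ sym (∑₁-distrib-+ s _ _) ⟩
    ∑₁ s (λ v → countSuffixes (opensWith? s v) (g ∷ gs)) ∎
    where
    open ≤-Reasoning
    tight⇒opens : ∀ gs → indicator (tight? s (g ∷ gs)) ≤ ∑₁ s (λ v → indicator (opensWith? s v (g ∷ gs)))
    tight⇒opens gs with tight? s (g ∷ gs)
    ... | no _ = z≤n
    tight⇒opens (g′ ∷ gs′) | yes (g≤s , g′≤s) =
      ≤-trans (≤-reflexive (sym (indicator-yes (opensWith? s g (g ∷ g′ ∷ gs′)) (refl , g′≤s))))
              (term≤∑₁ s (λ v → indicator (opensWith? s v (g ∷ g′ ∷ gs′))) 1≤g g≤s)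

-- Increasing lists and greedy pair selection

Increasing : List ℕ → Set
Increasing = AllPairs _<_

gaps : List ℕ → List ℕ
gaps []           = []
gaps (x ∷ [])     = []
gaps (x ∷ y ∷ ys) = (y ∸ x) ∷ gaps (y ∷ ys)

gaps-positive : ∀ {xs} → Increasing xs → All (1 ≤_) (gaps xs)
gaps-positive {[]}         _                 = []
gaps-positive {x ∷ []}     _                 = []
gaps-positive {x ∷ y ∷ ys} ((x<y ∷ _) ∷ inc) = m<n⇒0<n∸m x<y ∷ gaps-positive inc

length-gaps : ∀ x xs → length (gaps (x ∷ xs)) ≡ length xs
length-gaps x []       = refl
length-gaps x (y ∷ ys) = cong suc (length-gaps y ys)

head+sum-gaps< : ∀ {n x xs} → Increasing (x ∷ xs) → All (_< n) (x ∷ xs) → x + sum (gaps (x ∷ xs)) < n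
head+sum-gaps< {n} {x} {[]}     _                 (x<n ∷ _)  = subst (_< n) (sym (+-identityʳ x)) x<n
head+sum-gaps< {n} {x} {y ∷ ys} ((x<y ∷ _) ∷ inc) (_ ∷ ys<n) = subst (_< n) telescope (head+sum-gaps< inc ys<n)
  where
  telescope : y + sum (gaps (y ∷ ys)) ≡ x + ((y ∸ x) + sum (gaps (y ∷ ys)))
  telescope = trans (cong (_+ sum (gaps (y ∷ ys))) (sym (m+[n∸m]≡n (<⇒≤ x<y)))) (+-assoc x (y ∸ x) _)

sum-gaps< : ∀ {n x xs} → Increasing (x ∷ xs) → All (_< n) (x ∷ xs) → sum (gaps (x ∷ xs)) < n
sum-gaps< {x = x} inc bounded = ≤-trans (s≤s (m≤n+m _ x)) (head+sum-gaps< inc bounded)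

gap-step : ∀ {x y ℓ} → x < y → y ∸ x ≡ ℓ → y ≡ x + ℓ
gap-step x<y refl = sym (m+[n∸m]≡n (<⇒≤ x<y))

countSuffixes-gaps-∷ : ∀ {P : List ℕ → Set} (P? : Decidable P) y ys →
                       countSuffixes P? (gaps (y ∷ ys)) ≤ suc (countSuffixes P? (gaps ys))
countSuffixes-gaps-∷ P? y []       = z≤n
countSuffixes-gaps-∷ P? y (z ∷ zs) = countSuffixes-∷-≤ P? (z ∸ y) (gaps (z ∷ zs))

module Patterns (ℓ : ℕ) (Tail : ℕ → List ℕ → Set) where

  data Pattern : ℕ → List ℕ → Set where
    skip : ∀ {m x xs} → Pattern m xs → Pattern m (x ∷ xs)
    last : ∀ {x y xs} → y ≡ x + ℓ → Tail y xs → Pattern 1 (x ∷ y ∷ xs)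
    pair : ∀ {m x y xs} → y ≡ x + ℓ → Pattern (suc m) xs → Pattern (suc (suc m)) (x ∷ y ∷ xs)

  -- pick p lists the chosen pairs; position 2m holds the first element after the last pair.
  pick : ∀ {m xs} → Pattern m xs → ℕ → ℕ
  pick (skip p)             j             = pick p j
  pick (last {x = x} _ _)   0             = x
  pick (last {y = y} _ _)   1             = y
  pick (last {xs = xs} _ _) (suc (suc _)) = fromMaybe 0 (head xs)
  pick (pair {x = x} _ _)   0             = x
  pick (pair {y = y} _ _)   1             = y
  pick (pair _ p)           (suc (suc j)) = pick p j

  pick-∈ : ∀ {m xs} (p : Pattern m xs) {j} → j < double m → pick p j ∈ xs
  pick-∈ (skip p)   lt                           = there (pick-∈ p lt)
  pick-∈ (last _ _) {0}           _              = here refl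
  pick-∈ (last _ _) {1}           _              = there (here refl)
  pick-∈ (last _ _) {suc (suc _)} (s≤s (s≤s ()))
  pick-∈ (pair _ _) {0}           _              = here refl
  pick-∈ (pair _ _) {1}           _              = there (here refl)
  pick-∈ (pair _ p) {suc (suc j)} (s≤s (s≤s lt)) = there (there (pick-∈ p lt))

  pick-increasing : ∀ {m xs} → Increasing xs → (p : Pattern m xs) → ∀ {j} → suc j < double m → pick p j < pick p (suc j)
  pick-increasing (_ ∷ inc)       (skip p)   lt                             = pick-increasing inc p lt
  pick-increasing ((x<y ∷ _) ∷ _) (last _ _) {0}           _                = x<y
  pick-increasing _               (last _ _) {suc _}       (s≤s (s≤s ()))
  pick-increasing ((x<y ∷ _) ∷ _) (pair _ _) {0}           _                = x<y
  pick-increasing (_ ∷ y<xs ∷ _)  (pair _ p) {1}           _                = All.lookup y<xs (pick-∈ p z<s)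
  pick-increasing (_ ∷ _ ∷ inc)   (pair _ p) {suc (suc j)} (s≤s (s≤s lt))   = pick-increasing inc p lt

  pick-paired : ∀ {m xs} (p : Pattern m xs) j → suc (double j) < double m → pick p (suc (double j)) ≡ pick p (double j) + ℓ
  pick-paired (skip p)    j       lt             = pick-paired p j lt
  pick-paired (last eq _) zero    _              = eq
  pick-paired (last _ _)  (suc _) (s≤s (s≤s ()))
  pick-paired (pair eq _) zero    _              = eq
  pick-paired (pair _ p)  (suc j) (s≤s (s≤s lt)) = pick-paired p j lt

  pick-paired-2* : ∀ {m xs} (p : Pattern m xs) j → suc (2 * j) < double m → pick p (suc (2 * j)) ≡ pick p (2 * j) + ℓ
  pick-paired-2* p j lt = subst (λ i → pick p (suc i) ≡ pick p i + ℓ) (double≡2* j)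
                            (pick-paired p j (subst (λ i → suc i < _) (sym (double≡2* j)) lt))

module Greedy (ℓ : ℕ) (Tail : ℕ → List ℕ → Set) {Start : List ℕ → Set} (start? : Decidable Start)
              (opens : ∀ {x y ys} → Increasing (x ∷ y ∷ ys) → Start (gaps (x ∷ y ∷ ys)) → y ≡ x + ℓ × Tail y ys) where

  open Patterns ℓ Tail public

  -- Take the first admissible pair and resume after it: each pair taken accounts for at most two
  -- admissible gaps, so a scan that finds no m + 1 pairs has seen at most 2m of them.
  greedy : ∀ m xs → Increasing xs → Pattern (suc m) xs ⊎ countSuffixes start? (gaps xs) ≤ double m
  greedy m []           _   = inj₂ z≤n
  greedy m (x ∷ [])     _   = inj₂ z≤n
  greedy m (x ∷ y ∷ ys) inc =
    extend (start? (gaps (x ∷ y ∷ ys))) (greedy m (y ∷ ys) (AllPairs.tail inc))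
           (λ m′ → greedy m′ ys (AllPairs.tail (AllPairs.tail inc)))
    where
    extend : ∀ {m} (start : Dec (Start (gaps (x ∷ y ∷ ys)))) →
             Pattern (suc m) (y ∷ ys) ⊎ countSuffixes start? (gaps (y ∷ ys)) ≤ double m →
             (∀ m′ → Pattern (suc m′) ys ⊎ countSuffixes start? (gaps ys) ≤ double m′) →
             Pattern (suc m) (x ∷ y ∷ ys) ⊎ indicator start + countSuffixes start? (gaps (y ∷ ys)) ≤ double m
    extend         (no _)      fromNext _     = Sum.map skip id fromNext
    extend {zero}  (yes start) _        _     = inj₁ (uncurry last (opens inc start))
    extend {suc m} (yes start) _        later =
      Sum.map (pair (proj₁ (opens inc start))) (λ few → s≤s (≤-trans (countSuffixes-gaps-∷ start? y ys) (s≤s few))) (later m)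

-- The complement of a transversal contains no member of the family

members : ∀ {n} → Subset n → List ℕ
members []            = []
members (inside ∷ p)  = 0 ∷ map suc (members p)
members (outside ∷ p) = map suc (members p)

members-increasing : ∀ {n} (p : Subset n) → Increasing (members p)
members-increasing []            = []
members-increasing (inside ∷ p)  =
  All.map⁺ (All.universal (λ _ → z<s) (members p)) ∷ AllPairs.map⁺ (AllPairs.map s<s (members-increasing p))
members-increasing (outside ∷ p) = AllPairs.map⁺ (AllPairs.map s<s (members-increasing p))

members-< : ∀ {n} (p : Subset n) → All (_< n) (members p)
members-< []            = []
members-< (inside ∷ p)  = z<s ∷ All.map⁺ (All.map s<s (members-< p))
members-< (outside ∷ p) = All.map⁺ (All.map s<s (members-< p))

length-members : ∀ {n} (p : Subset n) → length (members p) ≡ ∣ p ∣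
length-members []            = refl
length-members (inside ∷ p)  = cong suc (trans (length-map suc (members p)) (length-members p))
length-members (outside ∷ p) = trans (length-map suc (members p)) (length-members p)

∣p∣+length-members-∁p : ∀ {n} (p : Subset n) → ∣ p ∣ + length (members (∁ p)) ≡ n
∣p∣+length-members-∁p p = trans (cong (_+_ ∣ p ∣) (trans (length-members (∁ p)) (∣∁p∣≡n∸∣p∣ p))) (m+[n∸m]≡n (∣p∣≤n p))

∈-members⁺ : ∀ {n} {p : Subset n} {i} → i ∈ₛ p → toℕ i ∈ members p
∈-members⁺ {p = inside ∷ p}  Vec.here        = here refl
∈-members⁺ {p = inside ∷ p}  (Vec.there i∈p) = there (∈-map⁺ suc (∈-members⁺ i∈p))
∈-members⁺ {p = outside ∷ p} (Vec.there i∈p) = ∈-map⁺ suc (∈-members⁺ i∈p)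

∈-members⁻ : ∀ {n} {p : Subset n} {i} → toℕ i ∈ members p → i ∈ₛ p
∈-members⁻ {p = inside ∷ p}  {zero}  _    = Vec.here
∈-members⁻ {p = outside ∷ p} {zero}  0∈   with ∈-map⁻ suc 0∈
... | _ , _ , ()
∈-members⁻ {p = inside ∷ p}  {suc i} (there i+1∈) with ∈-map⁻ suc i+1∈
... | _ , i∈ , refl = Vec.there (∈-members⁻ i∈)
∈-members⁻ {p = outside ∷ p} {suc i} i+1∈ with ∈-map⁻ suc i+1∈
... | _ , i∈ , refl = Vec.there (∈-members⁻ i∈)

-- InFamily, for an enumeration f : ℕ → ℕ instead of Fin d → Fin n.
record FamilyShape (d s : ℕ) (f : ℕ → ℕ) : Set where
  field
    ascending : ∀ j → suc j < d → f j < f (suc j)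
    step      : ℕ
    1≤step    : 1 ≤ step
    step≤s    : step ≤ s
    paired    : ∀ j → suc (2 * j) < d → f (suc (2 * j)) ≡ f (2 * j) + step
    closing   : d % 2 ≡ 1 → ∀ m → suc (suc m) ≡ d → f (suc m) ≤ f m + s

no-member-in-complement : ∀ {n d s} {S : Subset n} → Transversal n d s S →
                          ∀ {f} → FamilyShape d s f → ¬ (∀ j → j < d → f j ∈ members (∁ S))
no-member-in-complement {n} {d} {s} {S} transversal {f} shape f∈∁S = outside-S (transversal i member)
  where
  open FamilyShape shape
  f<n : ∀ j → j < d → f j < n
  f<n j j<d = All.lookup (members-< (∁ S)) (f∈∁S j j<d)
  i : Fin d → Fin n
  i j = fromℕ< (f<n (toℕ j) (toℕ<n j))
  toℕ-i : ∀ j → toℕ (i j) ≡ f (toℕ j)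
  toℕ-i j = toℕ-fromℕ< (f<n (toℕ j) (toℕ<n j))
  at≡f : ∀ m (m<d : m < d) → at i m m<d ≡ f m
  at≡f m m<d = trans (toℕ-i (fromℕ< m<d)) (cong f (toℕ-fromℕ< m<d))
  member : InFamily n d s i
  member = (λ m m+1<d → subst₂ _<_ (sym (at≡f m (<-trans (n<1+n m) m+1<d))) (sym (at≡f (suc m) m+1<d)) (ascending m m+1<d))
         , (step , 1≤step , step≤s , λ j 2j+1<d →
              trans (at≡f _ 2j+1<d) (trans (paired j 2j+1<d) (cong (_+ step) (sym (at≡f (2 * j) (<-trans (n<1+n (2 * j)) 2j+1<d))))))
         , (λ odd m m+1<d m+2≡d → subst₂ _≤_ (sym (at≡f (suc m) m+1<d)) (cong (_+ s) (sym (at≡f m (<-trans (n<1+n m) m+1<d))))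
                                           (closing odd m m+2≡d))
  outside-S : ∃ (λ j → i j ∈ₛ S) → ⊥
  outside-S (j , i-j∈S) = x∈∁p⇒x∉p (∈-members⁻ (subst (_∈ members (∁ S)) (sym (toℕ-i j)) (f∈∁S (toℕ j) (toℕ<n j)))) i-j∈S

NoTail : ℕ → List ℕ → Set
NoTail _ _ = ⊤

Within : ℕ → ℕ → List ℕ → Set
Within s y []      = ⊥
Within s y (z ∷ _) = z ≤ y + s

opens-even : ∀ {ℓ x y ys} → Increasing (x ∷ y ∷ ys) → HeadIs ℓ (gaps (x ∷ y ∷ ys)) → y ≡ x + ℓ × NoTail y ys
opens-even ((x<y ∷ _) ∷ _) y∸x≡ℓ = gap-step x<y y∸x≡ℓ , tt

opens-odd : ∀ {s ℓ x y ys} → Increasing (x ∷ y ∷ ys) → OpensWith s ℓ (gaps (x ∷ y ∷ ys)) → y ≡ x + ℓ × Within s y ys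
opens-odd {ys = []}            _               ()
opens-odd {y = y} {ys = z ∷ _} ((x<y ∷ _) ∷ _) (y∸x≡ℓ , z∸y≤s) =
  gap-step x<y y∸x≡ℓ , ≤-trans (m≤n+m∸n z y) (+-monoʳ-≤ y z∸y≤s)

module _ {s ℓ : ℕ} where
  open Patterns ℓ (Within s)

  pick-closing : ∀ {k xs} → Increasing xs → (p : Pattern (suc k) xs) →
                 pick p (double (suc k)) ∈ xs × pick p (suc (double k)) < pick p (double (suc k))
                   × pick p (double (suc k)) ≤ pick p (suc (double k)) + s
  pick-closing (_ ∷ inc) (skip p) with pick-closing inc p
  ... | z∈xs , y<z , z≤y+s = there z∈xs , y<z , z≤y+s
  pick-closing (_ ∷ (y<z ∷ _) ∷ _) (last {xs = z ∷ _} _ z≤y+s) = there (there (here refl)) , y<z , z≤y+s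
  pick-closing (_ ∷ _ ∷ inc) (pair _ p) with pick-closing inc p
  ... | z∈xs , y<z , z≤y+s = there (there z∈xs) , y<z , z≤y+s

suc-double< : ∀ {j k} → double j < double k → suc (double j) < double k
suc-double< {zero}  {suc k} _              = s≤s (s≤s z≤n)
suc-double< {suc j} {suc k} (s≤s (s≤s lt)) = s≤s (s≤s (suc-double< lt))

module _ {ℓ s k : ℕ} {xs : List ℕ} (1≤ℓ : 1 ≤ ℓ) (ℓ≤s : ℓ ≤ s) (inc : Increasing xs) where

  even-shape : ∀ {d} (p : Patterns.Pattern ℓ NoTail (suc k) xs) → d % 2 ≡ 0 → d ≡ double (suc k) →
               FamilyShape d s (Patterns.pick ℓ NoTail p)
  even-shape p even refl = record
    { ascending = λ j → pick-increasing inc p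
    ; step      = ℓ
    ; 1≤step    = 1≤ℓ
    ; step≤s    = ℓ≤s
    ; paired    = pick-paired-2* p
    ; closing   = λ odd → contradiction (trans (sym even) odd) 0≢1+n
    }
    where open Patterns ℓ NoTail

  odd-shape : ∀ {d} (p : Patterns.Pattern ℓ (Within s) (suc k) xs) → d ≡ suc (double (suc k)) →
              FamilyShape d s (Patterns.pick ℓ (Within s) p)
  odd-shape p refl = record
    { ascending = ascending
    ; step      = ℓ
    ; 1≤step    = 1≤ℓ
    ; step≤s    = ℓ≤s
    ; paired    = λ j 2j+1<d → pick-paired-2* p j (pair-inside j 2j+1<d)
    ; closing   = λ { _ m refl → proj₂ (proj₂ (pick-closing inc p)) }
    }
    where
    open Patterns ℓ (Within s)
    pair-inside : ∀ j → suc (2 * j) < suc (double (suc k)) → suc (2 * j) < double (suc k)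
    pair-inside j lt = subst (λ i → suc i < double (suc k)) (double≡2* j)
                         (suc-double< (subst (_< double (suc k)) (sym (double≡2* j)) (s≤s⁻¹ lt)))
    ascending : ∀ j → suc j < suc (double (suc k)) → pick p j < pick p (suc j)
    ascending j j+1<d with m≤n⇒m<n∨m≡n (s≤s⁻¹ j+1<d)
    ... | inj₁ j+1<2k = pick-increasing inc p j+1<2k
    ... | inj₂ refl   = proj₁ (proj₂ (pick-closing inc p))

  odd-pick-∈ : (p : Patterns.Pattern ℓ (Within s) (suc k) xs) → ∀ j → j < suc (double (suc k)) →
               Patterns.pick ℓ (Within s) p j ∈ xs
  odd-pick-∈ p j j<d with m≤n⇒m<n∨m≡n (s≤s⁻¹ j<d)
  ... | inj₁ j<2k = Patterns.pick-∈ ℓ (Within s) p j<2k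
  ... | inj₂ refl = proj₁ (pick-closing inc p)

module _ {n d s : ℕ} {S : Subset n} (transversal : Transversal n d s S) {k : ℕ} where

  few-repeated-gaps : d % 2 ≡ 0 → d ≡ double (suc k) →
                      ∀ ℓ → 1 ≤ ℓ → ℓ ≤ s → countSuffixes (headIs? ℓ) (gaps (members (∁ S))) ≤ double k
  few-repeated-gaps even d≡ ℓ 1≤ℓ ℓ≤s = [ impossible , id ]′ (greedy k (members (∁ S)) inc)
    where
    open Greedy ℓ NoTail (headIs? ℓ) opens-even
    inc : Increasing (members (∁ S))
    inc = members-increasing (∁ S)
    impossible : Pattern (suc k) (members (∁ S)) → countSuffixes (headIs? ℓ) (gaps (members (∁ S))) ≤ double k
    impossible p = ⊥-elim (no-member-in-complement transversal (even-shape 1≤ℓ ℓ≤s inc p even d≡)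
                                                    (λ j j<d → pick-∈ p (subst (j <_) d≡ j<d)))

  few-opening-gaps : d ≡ suc (double (suc k)) →
                     ∀ ℓ → 1 ≤ ℓ → ℓ ≤ s → countSuffixes (opensWith? s ℓ) (gaps (members (∁ S))) ≤ double k
  few-opening-gaps d≡ ℓ 1≤ℓ ℓ≤s = [ impossible , id ]′ (greedy k (members (∁ S)) inc)
    where
    open Greedy ℓ (Within s) (opensWith? s ℓ) opens-odd
    inc : Increasing (members (∁ S))
    inc = members-increasing (∁ S)
    impossible : Pattern (suc k) (members (∁ S)) → countSuffixes (opensWith? s ℓ) (gaps (members (∁ S))) ≤ double k
    impossible p = ⊥-elim (no-member-in-complement transversal (odd-shape 1≤ℓ ℓ≤s inc p d≡)
                                                    (λ j j<d → odd-pick-∈ 1≤ℓ ℓ≤s inc p j (subst (j <_) d≡ j<d)))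

-- The lower bounds

even-length-bound : ∀ {n s k} xs → Increasing xs → All (_< n) xs →
                    (∀ v → 1 ≤ v → v ≤ s → countSuffixes (headIs? v) (gaps xs) ≤ double k) →
                    length xs * suc s ≤ n + suc k * s * suc s
even-length-bound             []       _   _       _   = z≤n
even-length-bound {n} {s} {k} (x ∷ xs) inc bounded few = begin
  suc s + length xs * suc s             ≡⟨ cong (λ L → suc s + L * suc s) (sym (length-gaps x xs)) ⟩
  suc s + length gs * suc s             ≤⟨ +-monoʳ-≤ (suc s) (length*≤sum+repeats s k gs (gaps-positive inc) few) ⟩
  suc s + (sum gs + k * (s * suc s))    ≡⟨ regroup s (sum gs) (k * (s * suc s)) ⟩
  suc (sum gs) + (s + k * (s * suc s))  ≤⟨ +-mono-≤ (sum-gaps< inc bounded) (+-monoˡ-≤ _ (m≤m*n s (suc s))) ⟩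
  n + (s * suc s + k * (s * suc s))     ≡⟨ collect n s k ⟩
  n + suc k * s * suc s                 ∎
  where
  open ≤-Reasoning
  gs : List ℕ
  gs = gaps (x ∷ xs)
  regroup : ∀ s S K → suc s + (S + K) ≡ suc S + (s + K)
  regroup = solve-∀
  collect : ∀ n s k → n + (s * suc s + k * (s * suc s)) ≡ n + suc k * s * suc s
  collect = solve-∀

odd-length-bound : ∀ {n s k} xs → 1 ≤ s → Increasing xs → All (_< n) xs →
                   (∀ v → 1 ≤ v → v ≤ s → countSuffixes (opensWith? s v) (gaps xs) ≤ double k) →
                   length xs * suc (suc s) ≤ 2 * n + 2 * suc k * s * suc (suc s)
odd-length-bound             []       _   _   _       _   = z≤n
odd-length-bound {n} {s} {k} (x ∷ xs) 1≤s inc bounded few = begin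
  P + length xs * P                           ≡⟨ cong (λ L → P + L * P) (sym (length-gaps x xs)) ⟩
  P + length gs * P                           ≤⟨ +-monoʳ-≤ P (tightBound s gs 1≤gs) ⟩
  P + (2 * sum gs + suc (tightCount s gs) * P) ≤⟨ +-monoʳ-≤ P (+-monoʳ-≤ (2 * sum gs) (*-monoˡ-≤ P (s≤s tight-few))) ⟩
  P + (2 * sum gs + suc (s * double k) * P)   ≡⟨ regroup P (sum gs) (s * double k) ⟩
  2 * sum gs + (2 + s * double k) * P         ≤⟨ +-mono-≤ (*-monoʳ-≤ 2 (<⇒≤ (sum-gaps< inc bounded)))
                                                           (*-monoˡ-≤ P (+-monoˡ-≤ (s * double k) (*-monoʳ-≤ 2 1≤s))) ⟩
  2 * n + (2 * s + s * double k) * P          ≡⟨ cong (λ t → 2 * n + (2 * s + s * t) * P) (double≡2* k) ⟩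
  2 * n + (2 * s + s * (2 * k)) * P           ≡⟨ collect n s k ⟩
  2 * n + 2 * suc k * s * P                   ∎
  where
  open ≤-Reasoning
  P : ℕ
  P = suc (suc s)
  gs : List ℕ
  gs = gaps (x ∷ xs)
  1≤gs : All (1 ≤_) gs
  1≤gs = gaps-positive inc
  tight-few : tightCount s gs ≤ s * double k
  tight-few = begin
    tightCount s gs                                ≤⟨ tightCount≤∑₁ s gs 1≤gs ⟩
    ∑₁ s (λ v → countSuffixes (opensWith? s v) gs) ≤⟨ ∑₁-mono-≤ s few ⟩
    ∑₁ s (λ _ → double k)                          ≡⟨ ∑₁-const s (double k) ⟩
    s * double k                                   ∎
  regroup : ∀ P S T → P + (2 * S + suc T * P) ≡ 2 * S + (2 + T) * P
  regroup = solve-∀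
  collect : ∀ n s k → 2 * n + (2 * s + s * (2 * k)) * suc (suc s) ≡ 2 * n + 2 * suc k * s * suc (suc s)
  collect = solve-∀

even⇒≡double-half : ∀ {d} → d % 2 ≡ 0 → d ≡ double (d / 2)
even⇒≡double-half {d} even = begin
  d                 ≡⟨ m≡m%n+[m/n]*n d 2 ⟩
  d % 2 + d / 2 * 2 ≡⟨ cong (_+ d / 2 * 2) even ⟩
  d / 2 * 2         ≡⟨ *-comm (d / 2) 2 ⟩
  2 * (d / 2)       ≡⟨ double≡2* (d / 2) ⟨
  double (d / 2)    ∎
  where open ≡-Reasoning

odd⇒≡suc-double-half : ∀ {d} → d % 2 ≡ 1 → d ≡ suc (double (d / 2))
odd⇒≡suc-double-half {d} odd = begin
  d                    ≡⟨ m≡m%n+[m/n]*n d 2 ⟩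
  d % 2 + d / 2 * 2    ≡⟨ cong (_+ d / 2 * 2) odd ⟩
  suc (d / 2 * 2)      ≡⟨ cong suc (*-comm (d / 2) 2) ⟩
  suc (2 * (d / 2))    ≡⟨ cong suc (double≡2* (d / 2)) ⟨
  suc (double (d / 2)) ∎
  where open ≡-Reasoning

half≡suc : ∀ {d} → 2 ≤ d → ∃ λ k → d / 2 ≡ suc k
half≡suc {d} 2≤d with d / 2 | m≥n⇒m/n>0 {d} {2} 2≤d
... | suc k | _ = k , refl

module _ {n d s : ℕ} {S : Subset n} (transversal : Transversal n d s S) (2≤d : 2 ≤ d) where

  even-transversal-bound : d % 2 ≡ 0 → length (members (∁ S)) * suc s ≤ 1 * n + d / 2 * s * suc s
  even-transversal-bound even with half≡suc 2≤d
  ... | k , half≡ = subst (λ h → length (members (∁ S)) * suc s ≤ 1 * n + h * s * suc s) (sym half≡)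
    (subst (length (members (∁ S)) * suc s ≤_) (cong (_+ suc k * s * suc s) (sym (*-identityˡ n)))
      (even-length-bound (members (∁ S)) (members-increasing (∁ S)) (members-< (∁ S))
        (few-repeated-gaps transversal even (trans (even⇒≡double-half even) (cong double half≡)))))

  odd-transversal-bound : d % 2 ≡ 1 → 1 ≤ s → length (members (∁ S)) * suc (suc s) ≤ 2 * n + 2 * (d / 2) * s * suc (suc s)
  odd-transversal-bound odd 1≤s with half≡suc 2≤d
  ... | k , half≡ = subst (λ h → length (members (∁ S)) * suc (suc s) ≤ 2 * n + 2 * h * s * suc (suc s)) (sym half≡)
    (odd-length-bound (members (∁ S)) 1≤s (members-increasing (∁ S)) (members-< (∁ S))
      (few-opening-gaps transversal (trans (odd⇒≡suc-double-half odd) (cong (suc ∘ double) half≡))))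

-- The periodic transversal

-- periodic s c n marks the positions i < n with i + c ≡ s (mod s + 1).
periodic : (s c n : ℕ) → Subset n
periodic s c zero    = []
periodic s c (suc n) with c ≟ s
... | yes _ = inside ∷ periodic s 0 n
... | no _  = outside ∷ periodic s (suc c) n

∣periodic∣ : ∀ s c n → c ≤ s → ∣ periodic s c n ∣ ≡ (n + c) / suc s
∣periodic∣ s c zero    c≤s = sym (m<n⇒m/n≡0 (s≤s c≤s))
∣periodic∣ s c (suc n) c≤s with c ≟ s
... | yes refl = begin
  suc ∣ periodic s 0 n ∣             ≡⟨ cong suc (∣periodic∣ s 0 n z≤n) ⟩
  suc ((n + 0) / suc s)              ≡⟨ cong (λ m → suc (m / suc s)) (trans (+-identityʳ n) (sym (m+n∸n≡m n s))) ⟩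
  suc ((suc n + s ∸ suc s) / suc s)  ≡⟨ m/n≡1+[m∸n]/n (s≤s (m≤n+m s n)) ⟨
  (suc n + s) / suc s                ∎
  where open ≡-Reasoning
... | no c≢s = trans (∣periodic∣ s (suc c) n (≤∧≢⇒< c≤s c≢s)) (cong (_/ suc s) (+-suc n c))

Spaced : ℕ → List ℕ → Set
Spaced s = AllPairs λ x y → x + s < y

periodic-spaced : ∀ s c n → c ≤ s → All (λ y → s ≤ y + c) (members (periodic s c n)) × Spaced s (members (periodic s c n))
periodic-spaced s c zero    _   = [] , []
periodic-spaced s c (suc n) c≤s with c ≟ s
... | yes refl = (≤-refl ∷ All.map⁺ (All.universal (λ y → m≤n+m s (suc y)) _))
               , All.map⁺ (All.map (λ {y} s≤y+0 → s≤s (subst (s ≤_) (+-identityʳ y) s≤y+0)) first) ∷ AllPairs.map⁺ (AllPairs.map s<s rest)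
  where
  first : All (λ y → s ≤ y + 0) (members (periodic s 0 n))
  first = proj₁ (periodic-spaced s 0 n z≤n)
  rest : Spaced s (members (periodic s 0 n))
  rest = proj₂ (periodic-spaced s 0 n z≤n)
... | no c≢s = All.map⁺ (All.map (λ {y} s≤y+1+c → subst (s ≤_) (+-suc y c) s≤y+1+c) first) , AllPairs.map⁺ (AllPairs.map s<s rest)
  where
  first : All (λ y → s ≤ y + suc c) (members (periodic s (suc c) n))
  first = proj₁ (periodic-spaced s (suc c) n (≤∧≢⇒< c≤s c≢s))
  rest : Spaced s (members (periodic s (suc c) n))
  rest = proj₂ (periodic-spaced s (suc c) n (≤∧≢⇒< c≤s c≢s))

spaced-apart : ∀ {s xs a b} → Spaced s xs → a ∈ xs → b ∈ xs → a < b → a + s < b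
spaced-apart (_ ∷ _)    (here refl) (here refl) a<b = ⊥-elim (<-irrefl refl a<b)
spaced-apart (a+s< ∷ _) (here refl) (there b∈)  _   = All.lookup a+s< b∈
spaced-apart (b+s< ∷ _) (there a∈)  (here refl) a<b = ⊥-elim (<-asym a<b (≤-trans (s≤s (m≤m+n _ _)) (All.lookup b+s< a∈)))
spaced-apart (_ ∷ sp)   (there a∈)  (there b∈)  a<b = spaced-apart sp a∈ b∈ a<b

periodic-complement-transversal : ∀ {n d s} → 2 ≤ d → Transversal n d s (∁ (periodic s 0 n))
periodic-complement-transversal {d = suc zero} (s≤s ())
periodic-complement-transversal {n} {suc (suc d)} {s} _ i (ascending , (ℓ , _ , ℓ≤s , paired) , _)
  with i zero ∈? ∁ (periodic s 0 n) | i (suc zero) ∈? ∁ (periodic s 0 n)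
... | yes i₀∈ | _       = zero , i₀∈
... | no _    | yes i₁∈ = suc zero , i₁∈
... | no i₀∉  | no i₁∉  = ⊥-elim (<⇒≱ (spaced-apart (proj₂ (periodic-spaced s 0 n z≤n)) (marked i₀∉) (marked i₁∉) i₀<i₁)
                                      (subst (_≤ toℕ (i zero) + s) (sym i₁≡i₀+ℓ) (+-monoʳ-≤ (toℕ (i zero)) ℓ≤s)))
  where
  marked : ∀ {j} → j ∉ ∁ (periodic s 0 n) → toℕ j ∈ members (periodic s 0 n)
  marked j∉ = ∈-members⁺ (x∉∁p⇒x∈p j∉)
  i₀<i₁ : toℕ (i zero) < toℕ (i (suc zero))
  i₀<i₁ = ascending 0 (s≤s (s≤s z≤n))
  i₁≡i₀+ℓ : toℕ (i (suc zero)) ≡ toℕ (i zero) + ℓ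
  i₁≡i₀+ℓ = paired 0 (s≤s (s≤s z≤n))

∣∁periodic∣ : ∀ s n → ∣ ∁ (periodic s 0 n) ∣ ≡ n ∸ n / suc s
∣∁periodic∣ s n = trans (∣∁p∣≡n∸∣p∣ (periodic s 0 n)) (cong (n ∸_) (trans (∣periodic∣ s 0 n z≤n) (cong (_/ suc s) (+-identityʳ n))))

⟦_⟧ : ℕ → ℚᵘ.ℚᵘ
⟦ n ⟧ = mkℚᵘ (+ n) 0

⟦⟧-+ : ∀ m n → ⟦ m + n ⟧ ≃ ⟦ m ⟧ +ᵘ ⟦ n ⟧
⟦⟧-+ m n = *≡* (trans (cong (ℤ._* + 1) (ℤ.pos-+ m n)) (identity (+ m) (+ n)))
  where
  identity : ∀ a b → (a ℤ.+ b) ℤ.* + 1 ≡ (a ℤ.* + 1 ℤ.+ b ℤ.* + 1) ℤ.* + 1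
  identity = ℤ-Solver.solve-∀

⟦⟧-* : ∀ m n → ⟦ m * n ⟧ ≃ ⟦ m ⟧ *ᵘ ⟦ n ⟧
⟦⟧-* m n = *≡* (cong (ℤ._* + 1) (ℤ.pos-* m n))

⟦⟧-mono-≤ : ∀ {m n} → m ≤ n → ⟦ m ⟧ ≤ᵘ ⟦ n ⟧
⟦⟧-mono-≤ {m} {n} m≤n = *≤* (subst₂ ℤ._≤_ (sym (ℤ.*-identityʳ (+ m))) (sym (ℤ.*-identityʳ (+ n))) (ℤ.+≤+ m≤n))

/-*-cancel : ∀ t a → mkℚᵘ (+ t) a *ᵘ ⟦ suc a ⟧ ≃ ⟦ t ⟧
/-*-cancel t a = *≡* (trans (ℤ.*-identityʳ _) (cong (λ x → + t ℤ.* + suc x) (sym (*-identityʳ a))))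

fraction-bound : ∀ {N M R K T A b : ℚᵘ.ℚᵘ} .{{_ : ℚᵘ.Positive A}} → M +ᵘ R ≃ N → b *ᵘ A ≃ T →
                 R *ᵘ A ≤ᵘ T *ᵘ N +ᵘ K *ᵘ A → N *ᵘ (1ℚᵘ -ᵘ b) -ᵘ K ≤ᵘ M
fraction-bound {N} {M} {R} {K} {T} {A} {b} M+R≃N bA≃T RA≤ = ℚᵘₚ.*-cancelʳ-≤-pos A (begin
  (N *ᵘ (1ℚᵘ -ᵘ b) -ᵘ K) *ᵘ A               ≃⟨ solve 4 (λ N b K A → (N :* (con 1ℚᵘ :- b) :- K) :* A := N :* A :- (N :* (b :* A) :+ K :* A))
                                                      ℚᵘₚ.≃-refl N b K A ⟩
  N *ᵘ A -ᵘ (N *ᵘ (b *ᵘ A) +ᵘ K *ᵘ A)       ≃⟨ ℚᵘₚ.+-cong (ℚᵘₚ.*-congʳ (ℚᵘₚ.≃-sym M+R≃N)) (ℚᵘₚ.-‿cong (ℚᵘₚ.+-congˡ (K *ᵘ A) NbA≃TN)) ⟩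
  (M +ᵘ R) *ᵘ A -ᵘ (T *ᵘ N +ᵘ K *ᵘ A)       ≃⟨ solve 4 (λ M R X A → (M :+ R) :* A :- X := M :* A :+ (R :* A :- X)) ℚᵘₚ.≃-refl M R (T *ᵘ N +ᵘ K *ᵘ A) A ⟩
  M *ᵘ A +ᵘ (R *ᵘ A -ᵘ (T *ᵘ N +ᵘ K *ᵘ A)) ≤⟨ ℚᵘₚ.+-monoʳ-≤ (M *ᵘ A) (ℚᵘₚ.p≤q⇒p-q≤0 RA≤) ⟩
  M *ᵘ A +ᵘ 0ℚᵘ                             ≃⟨ ℚᵘₚ.+-identityʳ (M *ᵘ A) ⟩
  M *ᵘ A                                    ∎)
  where
  open ℚᵘₚ.≤-Reasoning
  open +-*-Solver
  NbA≃TN : N *ᵘ (b *ᵘ A) ≃ T *ᵘ N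
  NbA≃TN = ℚᵘₚ.≃-trans (ℚᵘₚ.*-congˡ {N} bA≃T) (ℚᵘₚ.*-comm N T)

toℚᵘ-homo-- : ∀ p q → toℚᵘ (p -ℚ q) ≃ toℚᵘ p -ᵘ toℚᵘ q
toℚᵘ-homo-- p q = ℚᵘₚ.≃-trans (ℚₚ.toℚᵘ-homo-+ p (-ℚ q)) (ℚᵘₚ.+-congʳ (toℚᵘ p) (ℚₚ.toℚᵘ-homo‿- q))

-- ℕ→ℚ n, 1ℚ and (+ t) /ℚ suc a are definitionally fromℚᵘ of ⟦ n ⟧, 1ℚᵘ and mkℚᵘ (+ t) a.
ℚ-lower-bound : ∀ {n M r K t a} → M + r ≡ n → r * suc a ≤ t * n + K * suc a →
                (ℕ→ℚ n *ℚ (1ℚ -ℚ ((+ t) /ℚ suc a))) -ℚ ℕ→ℚ K ≤ℚ ℕ→ℚ M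
ℚ-lower-bound {n} {M} {r} {K} {t} {a} M+r≡n bound =
  ℚₚ.toℚᵘ-cancel-≤ (ℚᵘₚ.≤-respˡ-≃ (ℚᵘₚ.≃-sym toℚᵘ-lhs) (ℚᵘₚ.≤-respʳ-≃ (ℚᵘₚ.≃-sym (ℚₚ.toℚᵘ-fromℚᵘ ⟦ M ⟧))
    (fraction-bound {⟦ n ⟧} {⟦ M ⟧} {⟦ r ⟧} {⟦ K ⟧} {⟦ t ⟧} {⟦ suc a ⟧} {mkℚᵘ (+ t) a} M+r≃n (/-*-cancel t a) rA≤)))
  where
  t/a : ℚ
  t/a = (+ t) /ℚ suc a
  M+r≃n : ⟦ M ⟧ +ᵘ ⟦ r ⟧ ≃ ⟦ n ⟧
  M+r≃n = ℚᵘₚ.≃-trans (ℚᵘₚ.≃-sym (⟦⟧-+ M r)) (ℚᵘₚ.≃-reflexive (cong ⟦_⟧ M+r≡n))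
  rA≤ : ⟦ r ⟧ *ᵘ ⟦ suc a ⟧ ≤ᵘ ⟦ t ⟧ *ᵘ ⟦ n ⟧ +ᵘ ⟦ K ⟧ *ᵘ ⟦ suc a ⟧
  rA≤ = ℚᵘₚ.≤-respˡ-≃ (⟦⟧-* r (suc a))
          (ℚᵘₚ.≤-respʳ-≃ (ℚᵘₚ.≃-trans (⟦⟧-+ (t * n) (K * suc a)) (ℚᵘₚ.+-cong (⟦⟧-* t n) (⟦⟧-* K (suc a)))) (⟦⟧-mono-≤ bound))
  toℚᵘ-lhs : toℚᵘ ((ℕ→ℚ n *ℚ (1ℚ -ℚ t/a)) -ℚ ℕ→ℚ K) ≃ ⟦ n ⟧ *ᵘ (1ℚᵘ -ᵘ mkℚᵘ (+ t) a) -ᵘ ⟦ K ⟧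
  toℚᵘ-lhs = ℚᵘₚ.≃-trans (toℚᵘ-homo-- (ℕ→ℚ n *ℚ (1ℚ -ℚ t/a)) (ℕ→ℚ K)) (ℚᵘₚ.+-cong
    (ℚᵘₚ.≃-trans (ℚₚ.toℚᵘ-homo-* (ℕ→ℚ n) (1ℚ -ℚ t/a)) (ℚᵘₚ.*-cong (ℚₚ.toℚᵘ-fromℚᵘ ⟦ n ⟧)
      (ℚᵘₚ.≃-trans (toℚᵘ-homo-- 1ℚ t/a) (ℚᵘₚ.+-cong (ℚₚ.toℚᵘ-fromℚᵘ 1ℚᵘ) (ℚᵘₚ.-‿cong (ℚₚ.toℚᵘ-fromℚᵘ (mkℚᵘ (+ t) a)))))))
    (ℚᵘₚ.-‿cong (ℚₚ.toℚᵘ-fromℚᵘ ⟦ K ⟧)))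

complement-bound⇒ℚ-bound : ∀ {n a} (S : Subset n) t K → length (members (∁ S)) * suc a ≤ t * n + K * suc a →
                           (ℕ→ℚ n *ℚ (1ℚ -ℚ ((+ t) /ℚ suc a))) -ℚ ℕ→ℚ K ≤ℚ ℕ→ℚ ∣ S ∣
complement-bound⇒ℚ-bound S t K = ℚ-lower-bound {r = length (members (∁ S))} {K} {t} (∣p∣+length-members-∁p S)

theorem3p6 : (d : ℕ) → 2 ≤ d → (s : ℕ → ℕ) → (∀ n → 1 ≤ s n) → LittleO s →
    ∃ λ N → ∀ n → N ≤ n →
      ((d % 2 ≡ 0 → ∀ (S : Subset n) → Transversal n d (s n) S →
          (ℕ→ℚ n *ℚ (1ℚ -ℚ ((+ 1) /ℚ suc (s n)))) -ℚ ℕ→ℚ ((d / 2) * s n) ≤ℚ ℕ→ℚ ∣ S ∣)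
      × (d % 2 ≡ 1 → ∀ (S : Subset n) → Transversal n d (s n) S →
          (ℕ→ℚ n *ℚ (1ℚ -ℚ ((+ 2) /ℚ suc (suc (s n))))) -ℚ ℕ→ℚ (2 * (d / 2) * s n) ≤ℚ ℕ→ℚ ∣ S ∣)
      × (∃ λ (S : Subset n) → Transversal n d (s n) S × ∣ S ∣ ≡ n ∸ (n / suc (s n))))
-- The bounds hold for every n.
theorem3p6 d 2≤d s 1≤s _ = 0 , λ n _ →
    (λ even S transversal → complement-bound⇒ℚ-bound S 1 (d / 2 * s n) (even-transversal-bound transversal 2≤d even))
  , (λ odd S transversal → complement-bound⇒ℚ-bound S 2 (2 * (d / 2) * s n) (odd-transversal-bound transversal 2≤d odd (1≤s n)))
  , (∁ (periodic (s n) 0 n) , periodic-complement-transversal 2≤d , ∣∁periodic∣ (s n) n)
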